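{- Let $x$ be an Arnoux-Rauzy word over a finite alphabet $\mathbb A$ with $|\mathbb A|\geq 2$, let $\varepsilon=B_0,B_1,B_2,\ldots$ be its bispecial factors listed in order of increasing length, let $(a_k)_{k\geq1}$ be its directive sequence, and for $k\in\mathbb N$ let $S_k$ be the longest palindromic suffix of $B_{k-1}a_k$. Then for each $k\in\mathbb N$, $S_k$ occurs exactly once as a factor of $B_k$; in particular $S_k$ is not a factor of $B_{k-1}$.
   Context: An infinite word $x\in\mathbb A^{\mathbb N}$ is Arnoux-Rauzy if it is recurrent and for each $n\ge0$ it has exactly one right special factor $R_n$ and exactly one left special factor $L_n$ of length $n$, with $R_nc$ and $cL_n$ factors of $x$ for all $c\in\mathbb A$. A factor is bispecial if it is both right and left special. The directive sequence: for each $k\in\mathbb N$, $a_k$ is the unique letter such that $B_{k-1}a_k$ is a left special factor of $x$. (It is known that $B_k$ is the palindromic closure of $B_{k-1}a_k$: writing $B_{k-1}a_k=x_kS_k$, one has $B_k=x_kS_k\overline{x_k}$, where $\overline{\cdot}$ denotes reversal.) -}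

module Defs where

open import Data.Nat using (ℕ; zero; suc; _+_; _≤_; _<_)
open import Data.Fin using (Fin)
open import Data.List using (List; []; _∷_; _++_; _∷ʳ_; length; take; drop; reverse)
open import Data.Product using (Σ; ∃; _×_; _,_)
open import Relation.Binary.PropositionalEquality using (_≡_; _≢_)

slice : {A : Set} → (ℕ → A) → ℕ → ℕ → List A
slice x i zero    = []
slice x i (suc n) = x i ∷ slice x (suc i) n

Factor : {A : Set} → (ℕ → A) → List A → Set
Factor x w = ∃ λ i → slice x i (length w) ≡ w

Recurrent : {A : Set} → (ℕ → A) → Set
Recurrent x = ∀ w → Factor x w → ∀ m → ∃ λ i → m ≤ i × slice x i (length w) ≡ w

RightSpecial : {A : Set} → (ℕ → A) → List A → Set
RightSpecial x w = ∃ λ c → ∃ λ d → c ≢ d × Factor x (w ∷ʳ c) × Factor x (w ∷ʳ d)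

LeftSpecial : {A : Set} → (ℕ → A) → List A → Set
LeftSpecial x w = ∃ λ c → ∃ λ d → c ≢ d × Factor x (c ∷ w) × Factor x (d ∷ w)

Bispecial : {A : Set} → (ℕ → A) → List A → Set
Bispecial x w = RightSpecial x w × LeftSpecial x w

ArnouxRauzy : {A : Set} → (ℕ → A) → Set
ArnouxRauzy {A} x =
  Recurrent x ×
  (∀ n → ∃ λ R → length R ≡ n × RightSpecial x R
                 × (∀ R' → length R' ≡ n → RightSpecial x R' → R' ≡ R)
                 × (∀ (c : A) → Factor x (R ∷ʳ c))) ×
  (∀ n → ∃ λ L → length L ≡ n × LeftSpecial x L
                 × (∀ L' → length L' ≡ n → LeftSpecial x L' → L' ≡ L)
                 × (∀ (c : A) → Factor x (c ∷ L)))

Palindrome : {A : Set} → List A → Set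
Palindrome w = reverse w ≡ w

Suffix : {A : Set} → List A → List A → Set
Suffix s w = ∃ λ p → p ++ s ≡ w

IsLongestPalSuffix : {A : Set} → List A → List A → Set
IsLongestPalSuffix s w =
  Palindrome s × Suffix s w × (∀ t → Palindrome t → Suffix t w → length t ≤ length s)

OccursAt : {A : Set} → List A → List A → ℕ → Set
OccursAt u w i = i + length u ≤ length w × take (length u) (drop i w) ≡ u

FactorOf : {A : Set} → List A → List A → Set
FactorOf u w = ∃ λ i → OccursAt u w i

OccursExactlyOnce : {A : Set} → List A → List A → Set
OccursExactlyOnce u w = ∃ λ i → OccursAt u w i × (∀ j → OccursAt u w j → j ≡ i)

-- From the directive sequence alone we build, by Justin's recursion, palindromes pal j and blocks
-- block j e with pal (j+1) = block j a(j+1) · pal j (module Directive).  The heart of the proof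
-- (module Enumeration) is an induction on j showing at once that B j = pal j and that the blocks
-- are the return words of pal j in x: every occurrence of pal j · e extends to block j e · pal j,
-- with no occurrence of pal j in between.  The induction step compares B (j+1) with pal (j+1) using
-- the uniqueness of the special factors of each length and the completeness of the enumeration.
-- For the model words, S (k+1) is either the letter a(k+1), when it is fresh and hence absent from
-- pal k, or a(k+1) · pal i · a(k+1) for the last step i directed by a(k+1).  In the second case pal k
-- is a concatenation of level-i blocks (module Desubstitution) coded by a word with no factor
-- a(k+1) a(k+1), and the return property excludes occurrences of a(k+1) · pal i · a(k+1).  A length
-- count and the palindromicity of pal (k+1) finally show that the obvious occurrence of S (k+1) in
-- pal (k+1) = B (k+1) is the only one.
module Submission where

open import Defs
open import Data.Nat using (ℕ; zero; suc; _+_; _*_; _∸_; _≤_; _<_; z≤n; s≤s; NonZero; >-nonZero)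
open import Data.Nat.DivMod using (_%_; _/_; m≡m%n+[m/n]*n; m%n<n)
open import Data.Nat.Properties
  using (+-comm; +-assoc; +-suc; +-identityʳ; suc-injective; ≤-refl; ≤-trans; ≤-pred; <-trans; <-irrefl; <-asym; <-cmp;
         m≤m+n; m≤n+m; n≤1+n; <⇒≤; <⇒≱; m<n⇒m<1+n; n<1+n; m≤n⇒m⊓n≡m; m+[n∸m]≡n; m∸n≤m; m∸[m∸n]≡n; +-∸-comm; n≮0; m<n+m;
         +-monoʳ-≤; +-monoˡ-≤; +-monoʳ-<; +-monoˡ-<; +-cancelˡ-≤; +-cancelʳ-≤; +-cancelˡ-≡; m<m+n; <-≤-trans; m≤n⇒m<n∨m≡n; 1+n≰n)
open import Data.Fin using (Fin) renaming (zero to fzero; suc to fsuc; _≟_ to _≟F_)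
open import Data.List using (List; []; _∷_; _++_; _∷ʳ_; length; take; drop; reverse)
open import Data.List.Properties
  using (++-assoc; length-++; ++-identityʳ; reverse-++; unfold-reverse; ∷ʳ-injective; ∷ʳ-injectiveʳ; ∷-injective; ∷-injectiveˡ; ∷-injectiveʳ;
         length-take; length-drop; length-reverse; take++drop≡id; ≡-dec)
open import Data.Product using (Σ; ∃; ∃₂; _×_; _,_; proj₁; proj₂)
open import Data.Sum using (_⊎_; inj₁; inj₂)
open import Data.Empty using (⊥; ⊥-elim)
open import Relation.Nullary using (¬_; Dec; yes; no)
open import Data.List.Membership.Propositional using (_∈_)
open import Data.List.Membership.Propositional.Properties using (∈-++⁻; ∈-++⁺ʳ)
open import Data.List.Relation.Unary.Any using (here)
open import Relation.Binary.Definitions using (DecidableEquality; tri<; tri≈; tri>)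
open import Relation.Binary.PropositionalEquality using (_≡_; _≢_; refl; sym; trans; cong; cong₂; subst; subst₂; module ≡-Reasoning)

+-regroup : ∀ t m n → t + (m + n) ≡ t + n + m
+-regroup t m n = trans (cong (t +_) (+-comm m n)) (sym (+-assoc t n m))

module _ {A : Set} where

  length-∷ʳ : (w : List A) (c : A) → length (w ∷ʳ c) ≡ suc (length w)
  length-∷ʳ w c = trans (length-++ w) (+-comm (length w) 1)

  reverse-∷ʳ : (w : List A) (c : A) → reverse (w ∷ʳ c) ≡ c ∷ reverse w
  reverse-∷ʳ w c = reverse-++ w (c ∷ [])

  length-take-≤ : (n : ℕ) (w : List A) → n ≤ length w → length (take n w) ≡ n
  length-take-≤ n w n≤w = trans (length-take n w) (m≤n⇒m⊓n≡m n≤w)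

  take-length-++ : (u v : List A) → take (length u) (u ++ v) ≡ u
  take-length-++ []      v = refl
  take-length-++ (c ∷ u) v = cong (c ∷_) (take-length-++ u v)

  drop-length-++ : (u v : List A) → drop (length u) (u ++ v) ≡ v
  drop-length-++ []      v = refl
  drop-length-++ (c ∷ u) v = drop-length-++ u v

  ++-cancel-length : (u u' : List A) {v v' : List A} →
                     length u ≡ length u' → u ++ v ≡ u' ++ v' → u ≡ u' × v ≡ v'
  ++-cancel-length []      []       _   eq = refl , eq
  ++-cancel-length (c ∷ u) (c' ∷ u') len eq with ∷-injective eq
  ... | refl , eq' with ++-cancel-length u u' (suc-injective len) eq'
  ... | refl , eq'' = refl , eq''

  ++-overlap : (u v w z : List A) → u ++ v ≡ w ++ z → length u ≤ length w →
               ∃ λ m → w ≡ u ++ m × v ≡ m ++ z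
  ++-overlap []      v w       z eq _         = w , refl , eq
  ++-overlap (c ∷ u) v (d ∷ w) z eq (s≤s u≤w) with ∷-injective eq
  ... | refl , eq' with ++-overlap u v w z eq' u≤w
  ... | m , w≡um , v≡mz = m , cong (c ∷_) w≡um , v≡mz

  nonempty-snoc : (w : List A) → 1 ≤ length w → ∃₂ λ w' c → w ≡ w' ∷ʳ c
  nonempty-snoc (c ∷ [])     _ = [] , c , refl
  nonempty-snoc (c ∷ d ∷ w) _ with nonempty-snoc (d ∷ w) (s≤s z≤n)
  ... | w' , e , eq = c ∷ w' , e , cong (c ∷_) eq

  drop-suc : ∀ q (w : List A) → q < length w → ∃ λ h → drop q w ≡ h ∷ drop (suc q) w
  drop-suc zero    (h ∷ w) _         = h , refl
  drop-suc (suc q) (_ ∷ w) (s≤s q<w) = drop-suc q w q<w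

  letter-or-long : ∀ (w : List A) → 1 ≤ length w → (∃ λ c → w ≡ c ∷ []) ⊎ 2 ≤ length w
  letter-or-long (c ∷ [])    _ = inj₁ (c , refl)
  letter-or-long (c ∷ d ∷ w) _ = inj₂ (s≤s (s≤s z≤n))

  palindrome-ends : ∀ T → Palindrome T → 2 ≤ length T → ∃₂ λ c T' → T ≡ c ∷ (T' ∷ʳ c) × Palindrome T'
  palindrome-ends (c ∷ [])    _     (s≤s ())
  palindrome-ends (c ∷ d ∷ T) pal-T _ with nonempty-snoc (d ∷ T) (s≤s z≤n)
  ... | T' , e , dT≡ = c , T' , trans T≡ (cong (λ z → c ∷ (T' ∷ʳ z)) (sym (proj₂ inner))) , proj₁ inner
    where
    T≡ : c ∷ d ∷ T ≡ c ∷ (T' ∷ʳ e)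
    T≡ = cong (c ∷_) dT≡
    reversed : e ∷ (reverse T' ∷ʳ c) ≡ c ∷ (T' ∷ʳ e)
    reversed = begin
      e ∷ (reverse T' ∷ʳ c)        ≡⟨ cong (_∷ʳ c) (reverse-∷ʳ T' e) ⟨
      reverse (T' ∷ʳ e) ∷ʳ c       ≡⟨ unfold-reverse c (T' ∷ʳ e) ⟨
      reverse (c ∷ (T' ∷ʳ e))      ≡⟨ cong reverse T≡ ⟨
      reverse (c ∷ d ∷ T)          ≡⟨ pal-T ⟩
      c ∷ d ∷ T                    ≡⟨ T≡ ⟩
      c ∷ (T' ∷ʳ e)                ∎
      where open ≡-Reasoning
    inner : reverse T' ≡ T' × c ≡ e
    inner = ∷ʳ-injective (reverse T') T' (∷-injectiveʳ reversed)

  occursAt⇒split : (u w : List A) (i : ℕ) → OccursAt u w i →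
                   ∃₂ λ p s → w ≡ p ++ u ++ s × length p ≡ i
  occursAt⇒split u w i (bound , taken) =
    take i w , drop (length u) (drop i w) , split , length-take-≤ i w (≤-trans (m≤m+n i (length u)) bound)
    where
    open ≡-Reasoning
    split : w ≡ take i w ++ u ++ drop (length u) (drop i w)
    split = begin
      w                                                          ≡⟨ take++drop≡id i w ⟨
      take i w ++ drop i w                                       ≡⟨ cong (take i w ++_) (take++drop≡id (length u) (drop i w)) ⟨
      take i w ++ take (length u) (drop i w) ++ drop (length u) (drop i w)
                                                                 ≡⟨ cong (λ v → take i w ++ v ++ drop (length u) (drop i w)) taken ⟩
      take i w ++ u ++ drop (length u) (drop i w)                ∎

  split⇒occursAt : {w : List A} (p u s : List A) → w ≡ p ++ u ++ s → OccursAt u w (length p)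
  split⇒occursAt p u s refl = bound , taken
    where
    bound : length p + length u ≤ length (p ++ u ++ s)
    bound = subst (length p + length u ≤_) (sym (trans (length-++ p) (cong (length p +_) (length-++ u))))
                  (+-monoʳ-≤ (length p) (m≤m+n (length u) (length s)))
    taken : take (length u) (drop (length p) (p ++ u ++ s)) ≡ u
    taken = trans (cong (take (length u)) (drop-length-++ p (u ++ s))) (take-length-++ u s)

  data HasSquare (c : A) : List A → Set where
    square-here  : ∀ {w} → HasSquare c (c ∷ c ∷ w)
    square-there : ∀ {d w} → HasSquare c w → HasSquare c (d ∷ w)

  no-square-pair : ∀ {c d e} → ¬ (d ≡ c × e ≡ c) → ¬ HasSquare c (d ∷ e ∷ [])
  no-square-pair not-both square-here                     = not-both (refl , refl)
  no-square-pair not-both (square-there (square-there ()))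

  square-free-++ : ∀ {c} (u : List A) {b} (v : List A) → b ≢ c →
                   ¬ HasSquare c (u ∷ʳ b) → ¬ HasSquare c v → ¬ HasSquare c ((u ∷ʳ b) ++ v)
  square-free-++ []          v b≢c _  free-v square-here      = b≢c refl
  square-free-++ []          v b≢c _  free-v (square-there h) = free-v h
  square-free-++ (d ∷ [])    v b≢c _  free-v square-here      = b≢c refl
  square-free-++ (d ∷ [])    v b≢c free-u free-v (square-there h) =
    square-free-++ [] v b≢c (λ h' → free-u (square-there h')) free-v h
  square-free-++ (d ∷ e ∷ u) v b≢c free-u free-v square-here      = free-u square-here
  square-free-++ (d ∷ e ∷ u) v b≢c free-u free-v (square-there h) =
    square-free-++ (e ∷ u) v b≢c (λ h' → free-u (square-there h')) free-v h

module Slices {A : Set} (x : ℕ → A) where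

  Occ : ℕ → List A → Set
  Occ t w = slice x t (length w) ≡ w

  length-slice : ∀ t n → length (slice x t n) ≡ n
  length-slice t zero    = refl
  length-slice t (suc n) = cong suc (length-slice (suc t) n)

  slice-+ : ∀ t m n → slice x t (m + n) ≡ slice x t m ++ slice x (t + m) n
  slice-+ t zero    n = cong (λ s → slice x s n) (sym (+-identityʳ t))
  slice-+ t (suc m) n = cong (x t ∷_) (trans (slice-+ (suc t) m n) (cong (λ s → slice x (suc t) m ++ slice x s n) (sym (+-suc t m))))

  occ-++⁻ : ∀ t (u v : List A) → Occ t (u ++ v) → Occ t u × Occ (t + length u) v
  occ-++⁻ t u v o = ++-cancel-length (slice x t (length u)) u (length-slice t (length u)) split
    where
    split : slice x t (length u) ++ slice x (t + length u) (length v) ≡ u ++ v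
    split = trans (sym (slice-+ t (length u) (length v))) (trans (cong (slice x t) (sym (length-++ u))) o)

  occ-++⁺ : ∀ t (u v : List A) → Occ t u → Occ (t + length u) v → Occ t (u ++ v)
  occ-++⁺ t u v ou ov = trans (cong (slice x t) (length-++ u)) (trans (slice-+ t (length u) (length v)) (cong₂ _++_ ou ov))

  occ-prefix : ∀ t (u v : List A) → Occ t (u ++ v) → Occ t u
  occ-prefix t u v o = proj₁ (occ-++⁻ t u v o)

  occ-suffix : ∀ t (u v : List A) → Occ t (u ++ v) → Occ (t + length u) v
  occ-suffix t u v o = proj₂ (occ-++⁻ t u v o)

  occ-head : ∀ t c (w : List A) → Occ t (c ∷ w) → x t ≡ c
  occ-head t c w o = ∷-injectiveˡ o

  occ-tail : ∀ t c (w : List A) → Occ t (c ∷ w) → Occ (suc t) w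
  occ-tail t c w o = ∷-injectiveʳ o

  occ-snoc : ∀ t (w : List A) → Occ t w → Occ t (w ∷ʳ x (t + length w))
  occ-snoc t w o = occ-++⁺ t w (x (t + length w) ∷ []) o refl

  occ-reposition : ∀ {t t'} (w : List A) → t ≡ t' → Occ t w → Occ t' w
  occ-reposition w refl o = o

  occ-same : ∀ {t} {u v : List A} → Occ t u → Occ t v → length u ≡ length v → u ≡ v
  occ-same {t} ou ov len = trans (sym ou) (trans (cong (slice x t) len) ov)

  occ-prefix-of : ∀ {t} {u v : List A} → Occ t u → Occ t v → length u ≤ length v → ∃ λ s → v ≡ u ++ s
  occ-prefix-of {t} {u} {v} ou ov u≤v = slice x (t + length u) (length v ∸ length u) ,
    trans (sym ov) (trans (cong (slice x t) (sym (m+[n∸m]≡n u≤v)))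
      (trans (slice-+ t (length u) _) (cong (_++ slice x (t + length u) (length v ∸ length u)) ou)))

  factor-prefix : ∀ (u v : List A) → Factor x (u ++ v) → Factor x u
  factor-prefix u v (t , o) = t , occ-prefix t u v o

  factor-suffix : ∀ (u v : List A) → Factor x (u ++ v) → Factor x v
  factor-suffix u v (t , o) = t + length u , occ-suffix t u v o

module SpecialFactors {A : Set} (_≟_ : DecidableEquality A) (x : ℕ → A) (AR : ArnouxRauzy x) where

  open Slices x

  RS : List A → Set
  RS = RightSpecial x
  LS : List A → Set
  LS = LeftSpecial x

  rs-unique : ∀ {u v} → RS u → RS v → length u ≡ length v → u ≡ v
  rs-unique {u} {v} ru rv len with proj₁ (proj₂ AR) (length u)
  ... | _ , _ , _ , unique , _ = trans (unique u refl ru) (sym (unique v (sym len) rv))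

  ls-unique : ∀ {u v} → LS u → LS v → length u ≡ length v → u ≡ v
  ls-unique {u} {v} lu lv len with proj₂ (proj₂ AR) (length u)
  ... | _ , _ , _ , unique , _ = trans (unique u refl lu) (sym (unique v (sym len) lv))

  ls-extends : ∀ {u} → LS u → ∀ c → Factor x (c ∷ u)
  ls-extends {u} lu c with proj₂ (proj₂ AR) (length u)
  ... | _ , _ , _ , unique , extends = subst (λ w → Factor x (c ∷ w)) (sym (unique u refl lu)) (extends c)

  ls-prefix : ∀ u v → LS (u ++ v) → LS u
  ls-prefix u v (c , c' , c≢c' , f , f') = c , c' , c≢c' , factor-prefix (c ∷ u) v f , factor-prefix (c' ∷ u) v f'

  rs-suffix : ∀ u v → RS (u ++ v) → RS v
  rs-suffix u v (c , c' , c≢c' , f , f') = c , c' , c≢c' , drop-u c f , drop-u c' f'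
    where
    drop-u : ∀ c → Factor x ((u ++ v) ∷ʳ c) → Factor x (v ∷ʳ c)
    drop-u c f = factor-suffix u (v ∷ʳ c) (subst (Factor x) (++-assoc u v (c ∷ [])) f)

  ls-prefix-determined : ∀ {L} → LS L → ∀ Y → LS Y → length L ≤ length Y → Y ≡ L ++ drop (length L) Y
  ls-prefix-determined {L} ls-L Y ls-Y L≤Y = trans (sym (take++drop≡id n Y)) (cong (_++ drop n Y) take≡L)
    where
    n : ℕ
    n = length L
    take≡L : take n Y ≡ L
    take≡L = ls-unique (ls-prefix (take n Y) (drop n Y) (subst LS (sym (take++drop≡id n Y)) ls-Y)) ls-L
                       (length-take-≤ n Y L≤Y)

  rs-suffix-determined : ∀ {R} → RS R → ∀ Y → RS Y → length R ≤ length Y → ∃ λ Pre → Y ≡ Pre ++ R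
  rs-suffix-determined {R} rs-R Y rs-Y R≤Y = take m Y , trans (sym (take++drop≡id m Y)) (cong (take m Y ++_) drop≡R)
    where
    m : ℕ
    m = length Y ∸ length R
    drop≡R : drop m Y ≡ R
    drop≡R = rs-unique (rs-suffix (take m Y) (drop m Y) (subst RS (sym (take++drop≡id m Y)) rs-Y)) rs-R
                       (trans (length-drop m Y) (m∸[m∸n]≡n R≤Y))

  -- Being right special is decidable: compare with the right special factor of that length.
  rs? : ∀ w → Dec (RS w)
  rs? w with proj₁ (proj₂ AR) (length w)
  ... | R , _ , rs-R , unique , _ with ≡-dec _≟_ w R
  ...   | yes refl = yes rs-R
  ...   | no  w≢R  = no (λ rs-w → w≢R (unique w refl rs-w))

  not-rs⇒same-extension : ∀ u c c' → Factor x (u ∷ʳ c) → Factor x (u ∷ʳ c') → ¬ RS u → c ≡ c'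
  not-rs⇒same-extension u c c' f f' not-rs with c ≟ c'
  ... | yes c≡c' = c≡c'
  ... | no  c≢c' = ⊥-elim (not-rs (c , c' , c≢c' , f , f'))

  ls⇒factor : ∀ {u} → LS u → Factor x u
  ls⇒factor {u} (c , _ , _ , f , _) = factor-suffix (c ∷ []) u f

  empty-bispecial : (c c' : A) → c ≢ c' → Bispecial x []
  empty-bispecial c c' c≢c' = (c , c' , c≢c' , letter c , letter c') , (c , c' , c≢c' , letter c , letter c')
    where
    letter : ∀ c → Factor x (c ∷ [])
    letter c with proj₁ (proj₂ AR) 0
    ... | [] , _ , _ , _ , extends = extends c

-- For a directive sequence a(1), a(2), ... we define by Justin's recursion
--   pal 0 = ε,   pal (j+1) = block j a(j+1) ++ pal j,
--   block 0 e = e,   block (j+1) e = block j e                    if e = a(j+1)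
--                                  = block j a(j+1) ++ block j e  otherwise.
-- pal j is the j-th palindromic prefix of the standard episturmian word directed
-- by a, and block j e is the return word to pal j that ends with e.
module Directive {A : Set} (_≟_ : DecidableEquality A) (a : ℕ → A) where

  -- Case distinction on a decision, used to define block without a with-clause.
  pick : {P : Set} → Dec P → List A → List A → List A
  pick (yes _) u v = u
  pick (no  _) u v = v

  block : ℕ → A → List A
  block zero    e = e ∷ []
  block (suc j) e = pick (e ≟ a (suc j)) (block j e) (block j (a (suc j)) ++ block j e)

  pal : ℕ → List A
  pal zero    = []
  pal (suc j) = block j (a (suc j)) ++ pal j

  pal-block-commute : ∀ j e → pal j ++ reverse (block j e) ≡ block j e ++ pal j
  pal-block-commute zero e = refl
  pal-block-commute (suc j) e with e ≟ a (suc j)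
  ... | yes refl = begin
      (u ++ p) ++ reverse u  ≡⟨ ++-assoc u p (reverse u) ⟩
      u ++ (p ++ reverse u)  ≡⟨ cong (u ++_) (pal-block-commute j e) ⟩
      u ++ (u ++ p)          ∎
    where
    open ≡-Reasoning
    u : List A
    u = block j e
    p : List A
    p = pal j
  ... | no _ = begin
      (u ++ p) ++ reverse (u ++ v)           ≡⟨ cong ((u ++ p) ++_) (reverse-++ u v) ⟩
      (u ++ p) ++ (reverse v ++ reverse u)   ≡⟨ ++-assoc u p _ ⟩
      u ++ (p ++ (reverse v ++ reverse u))   ≡⟨ cong (u ++_) (++-assoc p (reverse v) _) ⟨
      u ++ ((p ++ reverse v) ++ reverse u)   ≡⟨ cong (λ w → u ++ (w ++ reverse u)) (pal-block-commute j e) ⟩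
      u ++ ((v ++ p) ++ reverse u)           ≡⟨ cong (u ++_) (++-assoc v p _) ⟩
      u ++ (v ++ (p ++ reverse u))           ≡⟨ cong (λ w → u ++ (v ++ w)) (pal-block-commute j (a (suc j))) ⟩
      u ++ (v ++ (u ++ p))                   ≡⟨ ++-assoc u v _ ⟨
      (u ++ v) ++ (u ++ p)                   ∎
    where
    open ≡-Reasoning
    u : List A
    u = block j (a (suc j))
    v : List A
    v = block j e
    p : List A
    p = pal j

  block-pal-palindrome : ∀ j e → reverse (pal j) ≡ pal j → reverse (block j e ++ pal j) ≡ block j e ++ pal j
  block-pal-palindrome j e pal-j = trans (reverse-++ (block j e) (pal j))
    (trans (cong (_++ reverse (block j e)) pal-j) (pal-block-commute j e))

  pal-palindrome : ∀ j → reverse (pal j) ≡ pal j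
  pal-palindrome zero    = refl
  pal-palindrome (suc j) = block-pal-palindrome j (a (suc j)) (pal-palindrome j)

  block-ends-with : ∀ j e → ∃ λ w → block j e ≡ w ∷ʳ e
  block-ends-with zero e = [] , refl
  block-ends-with (suc j) e with e ≟ a (suc j)
  ... | yes _ = block-ends-with j e
  ... | no  _ with block-ends-with j e
  ... | w , eq = block j (a (suc j)) ++ w , trans (cong (block j (a (suc j)) ++_) eq) (sym (++-assoc (block j (a (suc j))) w (e ∷ [])))

  block-pal-starts-with : ∀ j e → ∃ λ s → block j e ++ pal j ≡ pal j ++ e ∷ s
  block-pal-starts-with j e with block-ends-with j e
  ... | w , eq = reverse w , starts
    where
    open ≡-Reasoning
    starts : block j e ++ pal j ≡ pal j ++ e ∷ reverse w
    starts = begin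
      block j e ++ pal j            ≡⟨ pal-block-commute j e ⟨
      pal j ++ reverse (block j e)  ≡⟨ cong (λ v → pal j ++ reverse v) eq ⟩
      pal j ++ reverse (w ∷ʳ e)     ≡⟨ cong (pal j ++_) (reverse-∷ʳ w e) ⟩
      pal j ++ e ∷ reverse w        ∎

  pal-ends-with : ∀ m → ∃ λ w → pal (suc m) ≡ w ∷ʳ a 1
  pal-ends-with zero = [] , refl
  pal-ends-with (suc m) with pal-ends-with m
  ... | w , eq = u ++ w , trans (cong (u ++_) eq) (sym (++-assoc u w (a 1 ∷ [])))
    where
    u : List A
    u = block (suc m) (a (suc (suc m)))

  pal-suffix : ∀ m i → Suffix (pal i) (pal (m + i))
  pal-suffix zero    i = [] , refl
  pal-suffix (suc m) i with pal-suffix m i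
  ... | Pre , Pre++pal≡ = u ++ Pre , trans (++-assoc u Pre (pal i)) (cong (u ++_) Pre++pal≡)
    where
    u : List A
    u = block (m + i) (a (suc (m + i)))

  letter-pal-suffix : ∀ i k → i < k → Suffix (a (suc i) ∷ pal i) (pal k)
  letter-pal-suffix i k i<k with pal-suffix (k ∸ suc i) (suc i) | block-ends-with i (a (suc i))
  ... | Pre , Pre++pal≡ | u , u≡ = Pre ++ u , (begin
      (Pre ++ u) ++ a (suc i) ∷ pal i          ≡⟨ ++-assoc Pre u _ ⟩
      Pre ++ (u ++ a (suc i) ∷ pal i)          ≡⟨ cong (Pre ++_) (++-assoc u (a (suc i) ∷ []) (pal i)) ⟨
      Pre ++ ((u ∷ʳ a (suc i)) ++ pal i)       ≡⟨ cong (λ v → Pre ++ (v ++ pal i)) u≡ ⟨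
      Pre ++ pal (suc i)                       ≡⟨ Pre++pal≡ ⟩
      pal (k ∸ suc i + suc i)                  ≡⟨ cong pal (trans (+-comm (k ∸ suc i) (suc i)) (m+[n∸m]≡n i<k)) ⟩
      pal k                                    ∎)
    where open ≡-Reasoning

  Directed : ℕ → A → Set
  Directed j e = ∃ λ l → l < j × a (suc l) ≡ e

  Fresh : ℕ → A → Set
  Fresh j e = ∀ l → l < j → a (suc l) ≢ e

  LastDirected : ℕ → A → ℕ → Set
  LastDirected j e i = i < j × a (suc i) ≡ e × (∀ l → i < l → l < j → a (suc l) ≢ e)

  block-length : ∀ j e →
      (Fresh j e × length (block j e) ≡ suc (length (pal j)))
    ⊎ (∃ λ i → LastDirected j e i × length (block j e) + length (pal i) ≡ length (pal j))
  block-length zero e = inj₁ ((λ l ()) , refl)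
  block-length (suc j) e with e ≟ a (suc j)
  ... | yes refl = inj₂ (j , (n<1+n j , refl , none-between) , sym (length-++ (block j e)))
    where
    none-between : ∀ l → j < l → l < suc j → a (suc l) ≢ e
    none-between l j<l l<1+j = ⊥-elim (1+n≰n (≤-trans j<l (≤-pred l<1+j)))
  ... | no a≢e with block-length j e
  ... | inj₁ (fresh , len) = inj₁ (extend fresh , length-block)
    where
    extend : Fresh j e → Fresh (suc j) e
    extend fresh l (s≤s l≤j) with m≤n⇒m<n∨m≡n l≤j
    ... | inj₁ l<j  = fresh l l<j
    ... | inj₂ refl = λ eq → a≢e (sym eq)
    length-block : length (block j (a (suc j)) ++ block j e) ≡ suc (length (pal (suc j)))
    length-block = trans (length-++ (block j (a (suc j))))
      (trans (cong (length (block j (a (suc j))) +_) len) (trans (+-suc _ _) (cong suc (sym (length-++ (block j (a (suc j))))))))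
  ... | inj₂ (i , (i<j , ai≡e , after) , len) = inj₂ (i , (m<n⇒m<1+n i<j , ai≡e , extend) , length-block)
    where
    extend : ∀ l → i < l → l < suc j → a (suc l) ≢ e
    extend l i<l (s≤s l≤j) with m≤n⇒m<n∨m≡n l≤j
    ... | inj₁ l<j  = after l i<l l<j
    ... | inj₂ refl = λ eq → a≢e (sym eq)
    u : List A
    u = block j (a (suc j))
    length-block : length (u ++ block j e) + length (pal i) ≡ length (pal (suc j))
    length-block = trans (cong (_+ length (pal i)) (length-++ u))
      (trans (+-assoc (length u) _ _) (trans (cong (length u +_) len) (sym (length-++ u))))

  letters-of-block : ∀ j f {e} → e ∈ block j f → e ≡ f ⊎ Directed j e
  letters-of-block zero f (here e≡f) = inj₁ e≡f
  letters-of-block (suc j) f {e} e∈ with f ≟ a (suc j)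
  ... | yes _ = later (letters-of-block j f e∈)
    where
    later : e ≡ f ⊎ Directed j e → e ≡ f ⊎ Directed (suc j) e
    later (inj₁ e≡f) = inj₁ e≡f
    later (inj₂ (l , l<j , eq)) = inj₂ (l , m<n⇒m<1+n l<j , eq)
  ... | no _ with ∈-++⁻ (block j (a (suc j))) e∈
  ... | inj₁ e∈u with letters-of-block j (a (suc j)) e∈u
  ...   | inj₁ e≡a = inj₂ (j , n<1+n j , sym e≡a)
  ...   | inj₂ (l , l<j , eq) = inj₂ (l , m<n⇒m<1+n l<j , eq)
  letters-of-block (suc j) f {e} e∈ | no _ | inj₂ e∈v with letters-of-block j f e∈v
  ...   | inj₁ e≡f = inj₁ e≡f
  ...   | inj₂ (l , l<j , eq) = inj₂ (l , m<n⇒m<1+n l<j , eq)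

  letters-of-pal : ∀ j {e} → e ∈ pal j → Directed j e
  letters-of-pal (suc j) e∈ with ∈-++⁻ (block j (a (suc j))) e∈
  ... | inj₁ e∈u with letters-of-block j (a (suc j)) e∈u
  ...   | inj₁ e≡a = j , n<1+n j , sym e≡a
  ...   | inj₂ (l , l<j , eq) = l , m<n⇒m<1+n l<j , eq
  letters-of-pal (suc j) e∈ | inj₂ e∈p with letters-of-pal j e∈p
  ... | l , l<j , eq = l , m<n⇒m<1+n l<j , eq

  fresh-not-factor : ∀ j e → Fresh j e → ¬ FactorOf (e ∷ []) (pal j)
  fresh-not-factor j e fresh (t , occ) with occursAt⇒split (e ∷ []) (pal j) t occ
  ... | Pre , Suf , pal≡ , _ with letters-of-pal j (subst (e ∈_) (sym pal≡) (∈-++⁺ʳ Pre (here refl)))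
  ...   | l , l<j , al≡e = fresh l l<j al≡e

  Avoids : A → ℕ → Set
  Avoids c m = ∀ l → 0 < l → l < m → a (suc l) ≢ c

  avoids-≤ : ∀ {c} m → Avoids c (suc m) → Avoids c m
  avoids-≤ m avoids l 0<l l<m = avoids l 0<l (m<n⇒m<1+n l<m)

  BlockShape : A → List A → A → Set
  BlockShape c w e = (∃ λ w' → w ≡ c ∷ w') × (∃ λ w' → w ≡ w' ∷ʳ e) × ¬ HasSquare c w

  block-shape : ∀ {c} → a 1 ≡ c → ∀ m → Avoids c (suc m) → ∀ e → BlockShape c (block (suc m) e) e
  block-shape a1≡c zero _ e with e ≟ a 1
  ... | yes e≡a1 = ([] , cong (_∷ []) (trans e≡a1 a1≡c)) , ([] , refl) , λ { (square-there ()) }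
  ... | no  e≢a1 = (e ∷ [] , cong (_∷ e ∷ []) a1≡c) , (a 1 ∷ [] , refl) ,
                   no-square-pair (λ { (a1≡c , e≡c) → e≢a1 (trans e≡c (sym a1≡c)) })
  block-shape {c} a1≡c (suc m) avoids e with e ≟ a (suc (suc m))
  ... | yes _ = block-shape a1≡c m (avoids-≤ (suc m) avoids) e
  ... | no  _ with block-shape a1≡c m (avoids-≤ (suc m) avoids) (a (suc (suc m))) | block-shape a1≡c m (avoids-≤ (suc m) avoids) e
  ... | (u' , u-starts) , (u'' , u-ends) , free-u | _ , (v'' , v-ends) , free-v =
      (u' ++ v , cong (_++ v) u-starts) ,
      (u ++ v'' , trans (cong (u ++_) v-ends) (sym (++-assoc u v'' (e ∷ [])))) ,
      subst (λ w → ¬ HasSquare c (w ++ v)) (sym u-ends)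
            (square-free-++ u'' v b≢c (subst (λ w → ¬ HasSquare c w) u-ends free-u) free-v)
    where
    b : A
    b = a (suc (suc m))
    u : List A
    u = block (suc m) b
    v : List A
    v = block (suc m) e
    b≢c : b ≢ c
    b≢c = avoids (suc m) (s≤s z≤n) ≤-refl

  pal-shape : ∀ {c} → a 1 ≡ c → ∀ m → Avoids c (suc m) → (∃ λ w → pal (suc m) ≡ c ∷ w) × ¬ HasSquare c (pal (suc m))
  pal-shape a1≡c zero _ = ([] , cong (_∷ []) a1≡c) , λ { (square-there ()) }
  pal-shape {c} a1≡c (suc m) avoids
    with block-shape a1≡c m (avoids-≤ (suc m) avoids) (a (suc (suc m))) | pal-shape a1≡c m (avoids-≤ (suc m) avoids)
  ... | (u' , u-starts) , (u'' , u-ends) , free-u | _ , free-p =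
      (u' ++ p , cong (_++ p) u-starts) ,
      subst (λ w → ¬ HasSquare c (w ++ p)) (sym u-ends)
            (square-free-++ u'' p b≢c (subst (λ w → ¬ HasSquare c w) u-ends free-u) free-p)
    where
    b : A
    b = a (suc (suc m))
    p : List A
    p = pal (suc m)
    b≢c : b ≢ c
    b≢c = avoids (suc m) (s≤s z≤n) ≤-refl

-- The words of the shifted directive sequence a(i+1), a(i+2), ... describe how
-- pal (m+i) and block (m+i) e are concatenations of the level-i blocks block i f.
module Desubstitution {A : Set} (_≟_ : DecidableEquality A) (a : ℕ → A) where

  open Directive _≟_ a
  module Shifted (i : ℕ) = Directive _≟_ (λ n → a (n + i))

  expand : ℕ → List A → List A
  expand i []      = []
  expand i (f ∷ w) = block i f ++ expand i w

  expand-++ : ∀ i u v → expand i (u ++ v) ≡ expand i u ++ expand i v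
  expand-++ i []      v = refl
  expand-++ i (f ∷ u) v = trans (cong (block i f ++_) (expand-++ i u v)) (sym (++-assoc (block i f) (expand i u) (expand i v)))

  block-desubst : ∀ i m e → block (m + i) e ≡ expand i (Shifted.block i m e)
  block-desubst i zero e = sym (++-identityʳ (block i e))
  block-desubst i (suc m) e with e ≟ a (suc (m + i))
  ... | yes _ = block-desubst i m e
  ... | no  _ = trans (cong₂ _++_ (block-desubst i m (a (suc (m + i)))) (block-desubst i m e))
                      (sym (expand-++ i (Shifted.block i m (a (suc (m + i)))) (Shifted.block i m e)))

  pal-desubst : ∀ i m → pal (m + i) ≡ expand i (Shifted.pal i m) ++ pal i
  pal-desubst i zero    = refl
  pal-desubst i (suc m) = begin
      block (m + i) b ++ pal (m + i)                   ≡⟨ cong₂ _++_ (block-desubst i m b) (pal-desubst i m) ⟩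
      expand i u ++ (expand i v ++ pal i)              ≡⟨ ++-assoc (expand i u) _ _ ⟨
      (expand i u ++ expand i v) ++ pal i              ≡⟨ cong (_++ pal i) (expand-++ i u v) ⟨
      expand i (u ++ v) ++ pal i                       ∎
    where
    open ≡-Reasoning
    b : A
    b = a (suc (m + i))
    u : List A
    u = Shifted.block i m b
    v : List A
    v = Shifted.pal i m

  expand-pal-starts : ∀ i w → ∃ λ s → expand i w ++ pal i ≡ pal i ++ s
  expand-pal-starts-with : ∀ i g w → ∃ λ s → expand i (g ∷ w) ++ pal i ≡ (pal i ∷ʳ g) ++ s

  expand-pal-starts i [] = [] , sym (++-identityʳ (pal i))
  expand-pal-starts i (g ∷ w) with expand-pal-starts-with i g w
  ... | s , eq = g ∷ s , trans eq (++-assoc (pal i) (g ∷ []) s)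

  expand-pal-starts-with i g w with expand-pal-starts i w | block-pal-starts-with i g
  ... | s , eq | s' , eq' = s' ++ s , (begin
      (block i g ++ expand i w) ++ pal i    ≡⟨ ++-assoc (block i g) (expand i w) (pal i) ⟩
      block i g ++ (expand i w ++ pal i)    ≡⟨ cong (block i g ++_) eq ⟩
      block i g ++ (pal i ++ s)             ≡⟨ ++-assoc (block i g) (pal i) s ⟨
      (block i g ++ pal i) ++ s             ≡⟨ cong (_++ s) eq' ⟩
      (pal i ++ g ∷ s') ++ s                ≡⟨ ++-assoc (pal i) (g ∷ s') s ⟩
      pal i ++ g ∷ s' ++ s                  ≡⟨ ++-assoc (pal i) (g ∷ []) (s' ++ s) ⟨
      (pal i ∷ʳ g) ++ s' ++ s               ∎)
    where open ≡-Reasoning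

-- The bispecial factors of an Arnoux-Rauzy word x enumerated by B with directive sequence a.
-- The two distinct letters c₀, c₁ guarantee that the empty word is bispecial.

module Enumeration {A : Set} (_≟_ : DecidableEquality A) (c₀ c₁ : A) (c₀≢c₁ : c₀ ≢ c₁)
  (x : ℕ → A) (AR : ArnouxRauzy x)
  (B : ℕ → List A)
  (bis : ∀ k → Bispecial x (B k))
  (B-increasing : ∀ k → length (B k) < length (B (suc k)))
  (B-all : ∀ w → Bispecial x w → ∃ λ k → w ≡ B k)
  (a : ℕ → A)
  (ls-Ba : ∀ k → LeftSpecial x (B k ∷ʳ a (suc k))) where

  open Slices x
  open SpecialFactors _≟_ x AR
  open Directive _≟_ a
  open Desubstitution _≟_ a

  β : ℕ → ℕ
  β k = length (B k)

  β-< : ∀ {i j} → i < j → β i < β j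
  β-< {i} {suc j} (s≤s i≤j) with m≤n⇒m<n∨m≡n i≤j
  ... | inj₁ i<j  = <-trans (β-< i<j) (B-increasing j)
  ... | inj₂ refl = B-increasing i

  β-<⁻¹ : ∀ {i j} → β i < β j → i < j
  β-<⁻¹ {i} {j} βi<βj with <-cmp i j
  ... | tri< i<j _ _  = i<j
  ... | tri≈ _ refl _ = ⊥-elim (<-irrefl refl βi<βj)
  ... | tri> _ _ j<i  = ⊥-elim (<-asym βi<βj (β-< j<i))

  no-bispecial-between : ∀ j w → Bispecial x w → β j < length w → length w < β (suc j) → ⊥
  no-bispecial-between j w bis-w βj<w w<βj+1 with B-all w bis-w
  ... | i , refl = <-irrefl refl (≤-trans (β-<⁻¹ w<βj+1) (β-<⁻¹ βj<w))

  B-zero : B 0 ≡ []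
  B-zero with B-all [] (empty-bispecial c₀ c₁ c₀≢c₁)
  ... | zero  , []≡B0 = sym []≡B0
  ... | suc k , []≡Bk = ⊥-elim (n≮0 (subst (β 0 <_) (sym (cong length []≡Bk)) (β-< (s≤s z≤n))))

  Return : ℕ → A → Set
  Return j e = ∀ t → Occ t (pal j ∷ʳ e) →
    Occ t (block j e ++ pal j) × (∀ t' → t < t' → t' < t + length (block j e) → ¬ Occ t' (pal j))

  Invariant : ℕ → Set
  Invariant j = B j ≡ pal j × (∀ e → Return j e)

  invariant-zero : Invariant 0
  invariant-zero = B-zero , λ e t o → o , λ t' t<t' t'<t+1 _ →
    1+n≰n (≤-trans t<t' (≤-pred (subst (t' <_) (+-comm t 1) t'<t+1)))

  -- B' begins with
  -- the left special factor P α and ends with the right special factor P; at an occurrence t₀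
  -- of B', the return property places W at t₀ and no P strictly inside [t₀, t₀ + |u|].  Writing
  -- B' = Pre P, a short Pre contradicts this gap and |Pre| = |u| gives B' = W.  A long Pre is
  -- refuted separately according to whether α P is right special.
  module NextBispecial (j : ℕ) (IH : Invariant j) where
    P : List A
    P = pal j
    b : ℕ
    b = length P
    α : A
    α = a (suc j)
    u : List A
    u = block j α
    p : ℕ
    p = length u
    u' : List A
    u' = proj₁ (block-ends-with j α)
    W : List A
    W = u' ++ α ∷ P

    W≡pal : pal (suc j) ≡ W
    W≡pal = trans (cong (_++ P) (proj₂ (block-ends-with j α))) (++-assoc u' (α ∷ []) P)

    p≡ : p ≡ suc (length u')
    p≡ = trans (cong length (proj₂ (block-ends-with j α))) (length-∷ʳ u' α)

    0<p : 0 < p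
    0<p = subst (0 <_) (sym p≡) (s≤s z≤n)

    length-W : length W ≡ p + b
    length-W = trans (cong length (sym W≡pal)) (length-++ u)

    Bj≡P : B j ≡ P
    Bj≡P = proj₁ IH

    returns : ∀ e → Return j e
    returns = proj₂ IH

    ls-P : LS P
    ls-P = subst LS Bj≡P (proj₂ (bis j))

    rs-P : RS P
    rs-P = subst RS Bj≡P (proj₁ (bis j))

    ls-Pα : LS (P ∷ʳ α)
    ls-Pα = subst (λ w → LS (w ∷ʳ α)) Bj≡P (ls-Ba j)

    B' : List A
    B' = B (suc j)
    N : ℕ
    N = length B'

    b<N : b < N
    b<N = subst (_< N) (cong length Bj≡P) (B-increasing j)

    t₀ : ℕ
    t₀ = proj₁ (ls⇒factor (proj₂ (bis (suc j))))

    occ-B' : Occ t₀ B'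
    occ-B' = proj₂ (ls⇒factor (proj₂ (bis (suc j))))

    B'-starts : B' ≡ (P ∷ʳ α) ++ drop (length (P ∷ʳ α)) B'
    B'-starts = ls-prefix-determined ls-Pα B' (proj₂ (bis (suc j))) (subst (_≤ N) (sym (length-∷ʳ P α)) b<N)

    occ-Pα : Occ t₀ (P ∷ʳ α)
    occ-Pα = occ-prefix t₀ (P ∷ʳ α) _ (subst (Occ t₀) B'-starts occ-B')

    occ-uP : Occ t₀ (u ++ P)
    occ-uP = proj₁ (returns α t₀ occ-Pα)

    occ-W : Occ t₀ W
    occ-W = subst (Occ t₀) W≡pal occ-uP

    gap : ∀ t' → t₀ < t' → t' < t₀ + p → ¬ Occ t' P
    gap = proj₂ (returns α t₀ occ-Pα)

    length-B' : ∀ Pre → B' ≡ Pre ++ P → N ≡ length Pre + b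
    length-B' Pre B'≡ = trans (cong length B'≡) (length-++ Pre)

    Pre-nonempty : ∀ Pre → B' ≡ Pre ++ P → 1 ≤ length Pre
    Pre-nonempty Pre B'≡ = +-cancelʳ-≤ b 1 (length Pre) (subst (suc b ≤_) (length-B' Pre B'≡) b<N)

    occ-final-P : ∀ Pre → B' ≡ Pre ++ P → Occ (t₀ + length Pre) P
    occ-final-P Pre B'≡ = occ-suffix t₀ Pre P (subst (Occ t₀) B'≡ occ-B')

    rs-last-letter : ∀ Pre₁ g → B' ≡ (Pre₁ ∷ʳ g) ++ P → B' ≡ Pre₁ ++ g ∷ P × RS (g ∷ P)
    rs-last-letter Pre₁ g B'≡ = B'≡' , rs-suffix Pre₁ (g ∷ P) (subst RS B'≡' (proj₁ (bis (suc j))))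
      where
      B'≡' : B' ≡ Pre₁ ++ g ∷ P
      B'≡' = trans B'≡ (++-assoc Pre₁ (g ∷ []) P)

    short-impossible : ∀ Pre → B' ≡ Pre ++ P → length Pre < p → ⊥
    short-impossible Pre B'≡ Pre<p =
      gap (t₀ + length Pre) (m<m+n t₀ (Pre-nonempty Pre B'≡)) (+-monoʳ-< t₀ Pre<p) (occ-final-P Pre B'≡)

    -- If α P is right special, a long B' = Pre P ends with W (we extend the common suffix
    -- α P of B' and W letter by letter to the left; a mismatch would make the remaining
    -- suffix of W left special and put an occurrence of P into the gap).  Then W is a
    -- bispecial factor strictly between B j and B'.
    module RightSpecialCase (rs-αP : RS (α ∷ P)) (Pre : List A) (B'≡ : B' ≡ Pre ++ P) (p<Pre : p < length Pre) where

      W<N : length W < N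
      W<N = subst₂ _<_ (sym length-W) (sym (length-B' Pre B'≡)) (+-monoˡ-< b p<Pre)

      length-W' : length W ≡ length u' + suc b
      length-W' = length-++ u'

      q<W : ∀ q → suc q ≤ length u' → q < length W
      q<W q q<u' = subst (q <_) (sym length-W') (≤-trans q<u' (m≤m+n (length u') (suc b)))

      suffix-αP : ∃ λ Pre' → B' ≡ Pre' ++ α ∷ P
      suffix-αP with nonempty-snoc Pre (≤-trans (s≤s z≤n) p<Pre)
      ... | Pre₁ , g , Pre≡ with rs-last-letter Pre₁ g (trans B'≡ (cong (_++ P) Pre≡))
      ... | B'≡' , rs-gP = Pre₁ , trans B'≡' (cong (Pre₁ ++_) (rs-unique rs-gP rs-αP refl))

      extend-suffix : ∀ q → suc q ≤ length u' → ∀ Pre' → B' ≡ Pre' ++ drop (suc q) W →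
                      ∃ λ Pre'' → B' ≡ Pre'' ++ drop q W
      extend-suffix q q<u' [] B'≡Y = ⊥-elim (<-irrefl refl (<-≤-trans W<N N≤W))
        where
        N≤W : N ≤ length W
        N≤W = subst (_≤ length W) (sym (trans (cong length B'≡Y) (length-drop (suc q) W))) (m∸n≤m (length W) (suc q))
      extend-suffix q q<u' (g₀ ∷ Pre₀) B'≡Y with nonempty-snoc (g₀ ∷ Pre₀) (s≤s z≤n) | drop-suc q W (q<W q q<u')
      ... | Pre₁ , g , Pre≡ | h , drop-q with g ≟ h
      ...   | yes refl = Pre₁ , trans B'≡gY (cong (Pre₁ ++_) (sym drop-q))
        where
        B'≡gY : B' ≡ Pre₁ ++ g ∷ drop (suc q) W
        B'≡gY = trans B'≡Y (trans (cong (_++ drop (suc q) W) Pre≡) (++-assoc Pre₁ (g ∷ []) _))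
      ...   | no g≢h = ⊥-elim (gap (t₀ + suc q) (m<m+n t₀ (s≤s z≤n)) in-gap occ-P)
        where
        Y : List A
        Y = drop (suc q) W
        B'≡gY : B' ≡ Pre₁ ++ g ∷ Y
        B'≡gY = trans B'≡Y (trans (cong (_++ Y) Pre≡) (++-assoc Pre₁ (g ∷ []) Y))
        W≡hY : W ≡ take q W ++ h ∷ Y
        W≡hY = trans (sym (take++drop≡id q W)) (cong (take q W ++_) drop-q)
        ls-Y : LS Y
        ls-Y = g , h , g≢h , factor-suffix Pre₁ (g ∷ Y) (subst (Factor x) B'≡gY (t₀ , occ-B'))
                           , factor-suffix (take q W) (h ∷ Y) (subst (Factor x) W≡hY (t₀ , occ-W))
        b≤Y : b ≤ length Y
        b≤Y = subst (b ≤_) (sym (trans (length-drop (suc q) W) (trans (cong (_∸ suc q) length-W') (+-∸-comm (suc b) q<u'))))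
                    (≤-trans (n≤1+n b) (m≤n+m (suc b) (length u' ∸ suc q)))
        occ-Y : Occ (t₀ + suc q) Y
        occ-Y = occ-reposition Y (cong (t₀ +_) (length-take-≤ (suc q) W (q<W q q<u')))
                  (occ-suffix t₀ (take (suc q) W) Y (subst (Occ t₀) (sym (take++drop≡id (suc q) W)) occ-W))
        occ-P : Occ (t₀ + suc q) P
        occ-P = occ-prefix _ P _ (subst (Occ _) (ls-prefix-determined ls-P Y ls-Y b≤Y) occ-Y)
        in-gap : t₀ + suc q < t₀ + p
        in-gap = +-monoʳ-< t₀ (subst (suc q <_) (sym p≡) (s≤s q<u'))

      suffix-from : ∀ k q → q + k ≡ length u' → ∃ λ Pre' → B' ≡ Pre' ++ drop q W
      suffix-from zero q q≡u' with suffix-αP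
      ... | Pre' , B'≡' = Pre' , trans B'≡' (cong (Pre' ++_) (sym drop-u'))
        where
        drop-u' : drop q W ≡ α ∷ P
        drop-u' = trans (cong (λ n → drop n W) (trans (sym (+-identityʳ q)) q≡u')) (drop-length-++ u' (α ∷ P))
      suffix-from (suc k) q q+k≡u' with suffix-from k (suc q) (trans (sym (+-suc q k)) q+k≡u')
      ... | Pre' , B'≡' = extend-suffix q (subst (suc q ≤_) (trans (sym (+-suc q k)) q+k≡u') (m≤m+n (suc q) k)) Pre' B'≡'

      impossible : ⊥
      impossible with suffix-from (length u') 0 refl | occ-prefix-of occ-W occ-B' (<⇒≤ W<N)
      ... | Pre' , B'≡Pre'W | s , B'≡Ws = no-bispecial-between j W (rs-W , ls-W) βj<W W<N
        where
        rs-W : RS W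
        rs-W = rs-suffix Pre' W (subst RS B'≡Pre'W (proj₁ (bis (suc j))))
        ls-W : LS W
        ls-W = ls-prefix W s (subst LS B'≡Ws (proj₂ (bis (suc j))))
        βj<W : β j < length W
        βj<W = subst₂ _<_ (sym (cong length Bj≡P)) (sym length-W) (+-monoˡ-< b 0<p)

    -- If α P is not right special, every occurrence of α P is followed by α, so the
    -- occurrences of P α (and of W) repeat with period |u| from t₀ onwards; the final P of
    -- a long B' = Pre P then either falls into a gap or forces α P to be right special.
    module NotRightSpecialCase (not-rs : ¬ RS (α ∷ P)) where

      advance : ∀ s → Occ s (P ∷ʳ α) → Occ (s + p) (P ∷ʳ α)
      advance s o = occ-reposition (P ∷ʳ α) position (occ-tail s' α (P ∷ʳ α) occ-αPα)
        where
        s' : ℕ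
        s' = s + length u'
        occ-αP : Occ s' (α ∷ P)
        occ-αP = occ-suffix s u' (α ∷ P) (subst (Occ s) W≡pal (proj₁ (returns α s o)))
        next≡α : x (s' + length (α ∷ P)) ≡ α
        next≡α = not-rs⇒same-extension (α ∷ P) _ α (s' , occ-snoc s' (α ∷ P) occ-αP) (ls-extends ls-Pα α) not-rs
        occ-αPα : Occ s' (α ∷ (P ∷ʳ α))
        occ-αPα = subst (λ c → Occ s' ((α ∷ P) ∷ʳ c)) next≡α (occ-snoc s' (α ∷ P) occ-αP)
        position : suc s' ≡ s + p
        position = trans (sym (+-suc s (length u'))) (cong (s +_) (sym p≡))

      periodic : ∀ i → Occ (t₀ + i * p) (P ∷ʳ α)
      periodic zero    = occ-reposition (P ∷ʳ α) (sym (+-identityʳ t₀)) occ-Pα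
      periodic (suc i) = occ-reposition (P ∷ʳ α) (trans (+-assoc t₀ (i * p) p) (cong (t₀ +_) (+-comm (i * p) p)))
                                        (advance (t₀ + i * p) (periodic i))

      instance
        p-nonZero : NonZero p
        p-nonZero = >-nonZero 0<p

      impossible : ∀ Pre → B' ≡ Pre ++ P → p < length Pre → ⊥
      impossible Pre B'≡ p<Pre with length Pre % p | length Pre / p | m≡m%n+[m/n]*n (length Pre) p | m%n<n (length Pre) p
      ... | zero | zero | Pre≡0 | _ = <-irrefl refl (≤-trans (subst (p <_) Pre≡0 p<Pre) z≤n)
      ... | zero | suc i | Pre≡ | _ with nonempty-snoc Pre (≤-trans (s≤s z≤n) p<Pre)
      ...   | Pre₁ , g , Pre≡snoc with rs-last-letter Pre₁ g (trans B'≡ (cong (_++ P) Pre≡snoc))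
      ...     | B'≡' , rs-gP = not-rs (subst RS (occ-same occ-gP occ-αP refl) rs-gP)
        where
        s : ℕ
        s = t₀ + i * p
        occ-αP : Occ (s + length u') (α ∷ P)
        occ-αP = occ-suffix s u' (α ∷ P) (subst (Occ s) W≡pal (proj₁ (returns α s (periodic i))))
        Pre₁≡ : length Pre₁ ≡ length u' + i * p
        Pre₁≡ = suc-injective (trans (sym (length-∷ʳ Pre₁ g)) (trans (cong length (sym Pre≡snoc)) (trans Pre≡ (cong (_+ i * p) p≡))))
        occ-gP : Occ (s + length u') (g ∷ P)
        occ-gP = occ-reposition (g ∷ P) (trans (cong (t₀ +_) Pre₁≡) (+-regroup t₀ (length u') (i * p)))
                   (occ-suffix t₀ Pre₁ (g ∷ P) (subst (Occ t₀) B'≡' occ-B'))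
      impossible Pre B'≡ p<Pre | suc r | i | Pre≡ | r<p =
        proj₂ (returns α s (periodic i)) (t₀ + length Pre) s<Pre Pre<s+p (occ-final-P Pre B'≡)
        where
        s : ℕ
        s = t₀ + i * p
        Pre-position : t₀ + length Pre ≡ s + suc r
        Pre-position = trans (cong (t₀ +_) Pre≡) (+-regroup t₀ (suc r) (i * p))
        s<Pre : s < t₀ + length Pre
        s<Pre = subst (s <_) (sym Pre-position) (m<m+n s (s≤s z≤n))
        Pre<s+p : t₀ + length Pre < s + p
        Pre<s+p = subst (_< s + p) (sym Pre-position) (+-monoʳ-< s r<p)

    next-bispecial : B' ≡ pal (suc j)
    next-bispecial with rs-suffix-determined rs-P B' (proj₁ (bis (suc j))) (<⇒≤ b<N)
    ... | Pre , B'≡ with <-cmp (length Pre) p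
    ... | tri< Pre<p _ _ = ⊥-elim (short-impossible Pre B'≡ Pre<p)
    ... | tri≈ _ Pre≡p _ = occ-same occ-B' occ-uP (trans (length-B' Pre B'≡) (trans (cong (_+ b) Pre≡p) (sym (length-++ u))))
    ... | tri> _ _ p<Pre with rs? (α ∷ P)
    ...   | yes rs-αP = ⊥-elim (RightSpecialCase.impossible rs-αP Pre B'≡ p<Pre)
    ...   | no  not-rs = ⊥-elim (NotRightSpecialCase.impossible not-rs Pre B'≡ p<Pre)

  -- The induction step, second half: the return property at level j+1.  With P' = pal (j+1) = u P,
  -- an occurrence of P' α is u followed by an occurrence of P α, which returns to P' after |u|;
  -- an occurrence of P' e (e ≠ α) is u followed by P e, which returns after |block j e| to an
  -- occurrence of e P; as e P is not right special (that is α P, which is a suffix of the right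
  -- special factor B (j+1) = P'), it continues as e P α and returns once more to P'.
  module NextReturn (j : ℕ) (IH : Invariant j) (B'≡ : B (suc j) ≡ pal (suc j)) where
    open NextBispecial j IH using (P; α; u; u'; p; W≡pal; returns; ls-Pα)

    P' : List A
    P' = pal (suc j)

    rs-αP : RS (α ∷ P)
    rs-αP = rs-suffix u' (α ∷ P) (subst RS (trans B'≡ W≡pal) (proj₁ (bis (suc j))))

    occ-Pα-of : ∀ t → Occ t P' → Occ t (P ∷ʳ α)
    occ-Pα-of t o with block-pal-starts-with j α
    ... | rest , P'≡ = occ-prefix t (P ∷ʳ α) rest (subst (Occ t) (trans P'≡ (sym (++-assoc P (α ∷ []) rest))) o)

    occ-P-of : ∀ t → Occ t P' → Occ t P
    occ-P-of t o = occ-prefix t P (α ∷ []) (occ-Pα-of t o)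

    split-P'e : ∀ t e → Occ t (P' ∷ʳ e) → Occ t u × Occ (t + p) (P ∷ʳ e)
    split-P'e t e o = occ-++⁻ t u (P ∷ʳ e) (subst (Occ t) (++-assoc u P (e ∷ [])) o)

    gap-α : ∀ t e → Occ t (P' ∷ʳ e) → ∀ t' → t < t' → t' < t + p → ¬ Occ t' P
    gap-α t e o = proj₂ (returns α t (occ-Pα-of t (occ-prefix t P' (e ∷ []) o)))

    return-α : ∀ t → Occ t (P' ∷ʳ α) →
               Occ t (u ++ P') × (∀ t' → t < t' → t' < t + p → ¬ Occ t' P')
    return-α t o = occ-++⁺ t u P' occ-u (proj₁ (returns α (t + p) occ-Pα))
                 , λ t' t<t' t'<t+p o' → gap-α t α o t' t<t' t'<t+p (occ-P-of t' o')
      where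
      occ-u : Occ t u
      occ-u = proj₁ (split-P'e t α o)
      occ-Pα : Occ (t + p) (P ∷ʳ α)
      occ-Pα = proj₂ (split-P'e t α o)

    return-other : ∀ e → e ≢ α → ∀ t → Occ t (P' ∷ʳ e) →
                   Occ t ((u ++ block j e) ++ P') × (∀ t' → t < t' → t' < t + length (u ++ block j e) → ¬ Occ t' P')
    return-other e e≢α t o = subst (Occ t) (sym (++-assoc u v P')) (occ-++⁺ t u (v ++ P') occ-u (occ-++⁺ (t + p) v P' occ-v occ-P'₂))
                           , no-P'-inside
      where
      v : List A
      v = block j e
      v' : List A
      v' = proj₁ (block-ends-with j e)
      v≡ : v ≡ v' ∷ʳ e
      v≡ = proj₂ (block-ends-with j e)
      occ-u : Occ t u
      occ-u = proj₁ (split-P'e t e o)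
      occ-Pe : Occ (t + p) (P ∷ʳ e)
      occ-Pe = proj₂ (split-P'e t e o)
      occ-vP : Occ (t + p) (v ++ P)
      occ-vP = proj₁ (returns e (t + p) occ-Pe)
      gap-e : ∀ t' → t + p < t' → t' < t + p + length v → ¬ Occ t' P
      gap-e = proj₂ (returns e (t + p) occ-Pe)
      occ-v : Occ (t + p) v
      occ-v = occ-prefix (t + p) v P occ-vP
      s : ℕ
      s = t + p + length v'
      occ-eP : Occ s (e ∷ P)
      occ-eP = occ-suffix (t + p) v' (e ∷ P) (subst (Occ (t + p)) (trans (cong (_++ P) v≡) (++-assoc v' (e ∷ []) P)) occ-vP)
      not-rs-eP : ¬ RS (e ∷ P)
      not-rs-eP rs-eP = e≢α (∷-injectiveˡ (rs-unique rs-eP rs-αP refl))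
      next≡α : x (s + length (e ∷ P)) ≡ α
      next≡α = not-rs⇒same-extension (e ∷ P) _ α (s , occ-snoc s (e ∷ P) occ-eP) (ls-extends ls-Pα e) not-rs-eP
      occ-Pα₂ : Occ (t + p + length v) (P ∷ʳ α)
      occ-Pα₂ = occ-reposition (P ∷ʳ α)
                  (trans (sym (+-suc (t + p) (length v'))) (cong (t + p +_) (sym (trans (cong length v≡) (length-∷ʳ v' e)))))
                  (occ-tail s e (P ∷ʳ α) (subst (λ c → Occ s ((e ∷ P) ∷ʳ c)) next≡α (occ-snoc s (e ∷ P) occ-eP)))
      occ-P'₂ : Occ (t + p + length v) P'
      occ-P'₂ = proj₁ (returns α _ occ-Pα₂)
      no-P'-inside : ∀ t' → t < t' → t' < t + length (u ++ v) → ¬ Occ t' P'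
      no-P'-inside t' t<t' t'<end o' with <-cmp t' (t + p)
      ... | tri< t'<t+p _ _ = gap-α t e o t' t<t' t'<t+p (occ-P-of t' o')
      ... | tri≈ _ refl _   = e≢α (sym (∷ʳ-injectiveʳ P P (occ-same (occ-Pα-of t' o') occ-Pe (trans (length-∷ʳ P α) (sym (length-∷ʳ P e))))))
      ... | tri> _ _ t+p<t' = gap-e t' t+p<t' (subst (t' <_) (trans (cong (t +_) (length-++ u)) (sym (+-assoc t p (length v)))) t'<end)
                                    (occ-P-of t' o')

    return-next : ∀ e → Return (suc j) e
    return-next e with e ≟ a (suc j)
    ... | yes refl = return-α
    ... | no  e≢α  = return-other e e≢α

  invariant : ∀ j → Invariant j
  invariant zero    = invariant-zero
  invariant (suc j) = B'≡ , NextReturn.return-next j (invariant j) B'≡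
    where
    B'≡ : B (suc j) ≡ pal (suc j)
    B'≡ = NextBispecial.next-bispecial j (invariant j)

  ls-pal : ∀ k → LS (pal k)
  ls-pal k = subst LS (proj₁ (invariant k)) (proj₂ (bis k))

  rs-pal : ∀ k → RS (pal k)
  rs-pal k = subst RS (proj₁ (invariant k)) (proj₁ (bis k))

  -- If  Xs · d · T = pal k  with T a palindrome, then T is right special and T d is left special:
  -- T is a suffix of pal k, and by the palindromicity of pal k, T d is a prefix of it.
  interior-special : ∀ k Xs d T → Xs ++ d ∷ T ≡ pal k → Palindrome T → RS T × LS (T ∷ʳ d)
  interior-special k Xs d T Xs++dT≡ pal-T =
    rs-suffix (Xs ∷ʳ d) T (subst RS (trans (sym Xs++dT≡) (sym (++-assoc Xs (d ∷ []) T))) (rs-pal k)) ,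
    ls-prefix (T ∷ʳ d) (reverse Xs) (subst LS reversed (ls-pal k))
    where
    open ≡-Reasoning
    reversed : pal k ≡ (T ∷ʳ d) ++ reverse Xs
    reversed = begin
      pal k                             ≡⟨ pal-palindrome k ⟨
      reverse (pal k)                   ≡⟨ cong reverse Xs++dT≡ ⟨
      reverse (Xs ++ d ∷ T)             ≡⟨ reverse-++ Xs (d ∷ T) ⟩
      reverse (d ∷ T) ++ reverse Xs     ≡⟨ cong (_++ reverse Xs) (trans (unfold-reverse d T) (cong (_∷ʳ d) pal-T)) ⟩
      (T ∷ʳ d) ++ reverse Xs            ∎

  -- A palindromic suffix of length at least two of pal k · c is  c · pal i · c  for some step
  -- i < k directed by c: its interior is bispecial, hence some B i, and B i c is left special.
  palindromic-suffix-shape : ∀ k c T → Palindrome T → Suffix T (pal k ∷ʳ c) → 2 ≤ length T →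
                             ∃ λ i → i < k × a (suc i) ≡ c × T ≡ c ∷ (pal i ∷ʳ c)
  palindromic-suffix-shape k c T pal-T (Xs , Xs++T≡) 2≤T with palindrome-ends T pal-T 2≤T
  ... | d , T' , T≡ , pal-T'
    with ∷ʳ-injective (Xs ++ d ∷ T') (pal k) (trans (++-assoc Xs (d ∷ T') (d ∷ [])) (trans (cong (Xs ++_) (sym T≡)) Xs++T≡))
  ... | Xs++dT'≡ , d≡c with interior-special k Xs d T' Xs++dT'≡ pal-T'
  ... | rs-T' , ls-T'd with B-all T' (rs-T' , ls-prefix T' (d ∷ []) ls-T'd)
  ... | i , T'≡Bi = i , i<k , trans ai≡d d≡c , shape
    where
    ai≡d : a (suc i) ≡ d
    ai≡d = ∷ʳ-injectiveʳ (B i) (B i) (ls-unique (ls-Ba i) (subst (λ w → LS (w ∷ʳ d)) T'≡Bi ls-T'd)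
             (trans (length-∷ʳ (B i) _) (sym (length-∷ʳ (B i) d))))
    i<k : i < k
    i<k = β-<⁻¹ (subst₂ _<_ (cong length T'≡Bi) (cong length (sym (proj₁ (invariant k))))
            (subst (length T' <_) (trans (sym (length-++ Xs)) (cong length Xs++dT'≡)) (m≤n+m (suc (length T')) (length Xs))))
    shape : T ≡ c ∷ (pal i ∷ʳ c)
    shape = trans T≡ (cong₂ (λ e w → e ∷ (w ∷ʳ e)) d≡c (trans T'≡Bi (proj₁ (invariant i))))

  -- Inside an occurrence of  expand i Ds ++ pal i  the occurrences of pal i are exactly the block
  -- boundaries (by the return property at level i).  The word c · pal i · c therefore occurs there
  -- only around a boundary between two consecutive blocks ending with c, i.e. where Ds has a factor cc.
  module SquareOccurrence (i : ℕ) (c : A) where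

    n : ℕ
    n = length (pal i)
    cPc : List A
    cPc = c ∷ (pal i ∷ʳ c)

    length-cPc : length cPc ≡ suc (suc n)
    length-cPc = cong suc (length-∷ʳ (pal i) c)

    expand-cons : ∀ f Ds → expand i (f ∷ Ds) ++ pal i ≡ block i f ++ (expand i Ds ++ pal i)
    expand-cons f Ds = ++-assoc (block i f) (expand i Ds) (pal i)

    cPc-inside-block : ∀ f Ds T t → Occ T (expand i (f ∷ Ds) ++ pal i) → Occ (T + t) cPc →
                       suc t < length (block i f) → ⊥
    cPc-inside-block f Ds T t occ occ-cPc 1+t<ρ with expand-pal-starts-with i f Ds
    ... | s , starts = proj₂ (proj₂ (invariant i) f T occ-Pf) (suc (T + t)) (s≤s (m≤m+n T t))
                         (subst (_< T + length (block i f)) (+-suc T t) (+-monoʳ-< T 1+t<ρ))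
                         (occ-prefix _ (pal i) (c ∷ []) (occ-tail (T + t) c (pal i ∷ʳ c) occ-cPc))
      where
      occ-Pf : Occ T (pal i ∷ʳ f)
      occ-Pf = occ-prefix T (pal i ∷ʳ f) s (subst (Occ T) starts occ)

    cPc-at-boundary : ∀ f Ds T t → Occ T (expand i (f ∷ Ds) ++ pal i) →
                      t + length cPc ≤ length (expand i (f ∷ Ds) ++ pal i) → Occ (T + t) cPc →
                      suc t ≡ length (block i f) → HasSquare c (f ∷ Ds)
    cPc-at-boundary f Ds T t occ fits occ-cPc 1+t≡ρ with block-ends-with i f
    ... | L' , L≡ = next-letter Ds refl
      where
      L'≡t : length L' ≡ t
      L'≡t = suc-injective (trans (sym (length-∷ʳ L' f)) (trans (cong length (sym L≡)) (sym 1+t≡ρ)))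
      occ-L : Occ T (block i f)
      occ-L = occ-prefix T (block i f) _ (subst (Occ T) (expand-cons f Ds) occ)
      f≡c : f ≡ c
      f≡c = trans (sym (occ-head _ f [] (occ-reposition (f ∷ []) (cong (T +_) L'≡t)
                                          (occ-suffix T L' (f ∷ []) (subst (Occ T) L≡ occ-L)))))
                  (occ-head (T + t) c _ occ-cPc)
      next-letter : ∀ Ds' → Ds' ≡ Ds → HasSquare c (f ∷ Ds)
      next-letter [] refl = ⊥-elim (1+n≰n (≤-pred (subst₂ _≤_ lhs rhs fits)))
        where
        lhs : t + length cPc ≡ suc (suc (t + n))
        lhs = trans (cong (t +_) length-cPc) (trans (+-suc t (suc n)) (cong suc (+-suc t n)))
        rhs : length (expand i (f ∷ []) ++ pal i) ≡ suc (t + n)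
        rhs = trans (cong length (expand-cons f [])) (trans (length-++ (block i f)) (cong (_+ n) (sym 1+t≡ρ)))
      next-letter (g ∷ Ds') refl with expand-pal-starts-with i g Ds'
      ... | s , starts = subst₂ (λ e e' → HasSquare c (e ∷ e' ∷ Ds')) (sym f≡c) (sym g≡c) square-here
        where
        occ-Pg : Occ (T + length (block i f)) (pal i ∷ʳ g)
        occ-Pg = occ-prefix _ (pal i ∷ʳ g) s (subst (Occ _) starts (occ-suffix T (block i f) _ (subst (Occ T) (expand-cons f (g ∷ Ds')) occ)))
        occ-Pc : Occ (suc (T + t)) (pal i ∷ʳ c)
        occ-Pc = occ-tail (T + t) c (pal i ∷ʳ c) occ-cPc
        g≡c : g ≡ c
        g≡c = trans (sym (occ-head _ g [] (occ-suffix _ (pal i) (g ∷ []) occ-Pg)))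
                    (trans (cong (λ s' → x (s' + n)) (trans (cong (T +_) (sym 1+t≡ρ)) (+-suc T t)))
                           (occ-head _ c [] (occ-suffix _ (pal i) (c ∷ []) occ-Pc)))

    square-occurrence : ∀ Ds T t → Occ T (expand i Ds ++ pal i) →
                        t + length cPc ≤ length (expand i Ds ++ pal i) → Occ (T + t) cPc → HasSquare c Ds
    square-occurrence [] T t _ fits _ =
      ⊥-elim (1+n≰n (≤-trans (≤-trans (n≤1+n (suc n)) (m≤n+m (suc (suc n)) t)) (subst (λ m → t + m ≤ n) length-cPc fits)))
    square-occurrence (f ∷ Ds) T t occ fits occ-cPc with <-cmp (suc t) (length (block i f))
    ... | tri< 1+t<ρ _ _ = ⊥-elim (cPc-inside-block f Ds T t occ occ-cPc 1+t<ρ)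
    ... | tri≈ _ 1+t≡ρ _ = cPc-at-boundary f Ds T t occ fits occ-cPc 1+t≡ρ
    ... | tri> _ _ ρ<1+t = square-there (square-occurrence Ds (T + ρ) t' occ-rest fits-rest occ-cPc-rest)
      where
      ρ : ℕ
      ρ = length (block i f)
      t' : ℕ
      t' = t ∸ ρ
      ρ+t'≡t : ρ + t' ≡ t
      ρ+t'≡t = m+[n∸m]≡n (≤-pred ρ<1+t)
      occ-rest : Occ (T + ρ) (expand i Ds ++ pal i)
      occ-rest = occ-suffix T (block i f) _ (subst (Occ T) (expand-cons f Ds) occ)
      occ-cPc-rest : Occ (T + ρ + t') cPc
      occ-cPc-rest = occ-reposition cPc (trans (cong (T +_) (sym ρ+t'≡t)) (sym (+-assoc T ρ t'))) occ-cPc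
      fits-rest : t' + length cPc ≤ length (expand i Ds ++ pal i)
      fits-rest = +-cancelˡ-≤ ρ _ _ (subst₂ _≤_ (trans (cong (_+ length cPc) (sym ρ+t'≡t)) (+-assoc ρ t' _))
                                              (trans (cong length (expand-cons f Ds)) (length-++ (block i f))) fits)

  -- Either α is fresh, and S₀ = α; or S₀ = α · pal i · α for the last step i < k directed
  -- by α, and pal k is a concatenation of level-i blocks coded by a word without factor αα.  In both
  -- cases S₀ is not a factor of pal k, and |S₀| + |block k α| = |pal k| + 2; since pal (k+1) is a
  -- palindrome beginning with pal k · α, this makes the occurrence of S₀ ending at |pal k| + 1 its
  -- only occurrence in pal (k+1).
  module LongestPalindromicSuffix (k : ℕ) (S₀ : List A) (longest : IsLongestPalSuffix S₀ (pal k ∷ʳ a (suc k))) where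
    α : A
    α = a (suc k)
    n : ℕ
    n = length (pal k)
    p : ℕ
    p = length (block k α)

    pal-S₀ : Palindrome S₀
    pal-S₀ = proj₁ longest

    suffix-S₀ : Suffix S₀ (pal k ∷ʳ α)
    suffix-S₀ = proj₁ (proj₂ longest)

    maximal : ∀ T → Palindrome T → Suffix T (pal k ∷ʳ α) → length T ≤ length S₀
    maximal = proj₂ (proj₂ longest)

    Core : Set
    Core = length S₀ + p ≡ suc (suc n) × ¬ FactorOf S₀ (pal k)

    fresh-case : Fresh k α → p ≡ suc n → Core
    fresh-case fresh p≡ with letter-or-long S₀ (maximal (α ∷ []) refl (pal k , refl))
    ... | inj₂ 2≤S₀ = ⊥-elim (never-directed (palindromic-suffix-shape k α S₀ pal-S₀ suffix-S₀ 2≤S₀))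
      where
      never-directed : ¬ (∃ λ i → i < k × a (suc i) ≡ α × S₀ ≡ α ∷ (pal i ∷ʳ α))
      never-directed (i , i<k , ai≡α , _) = fresh i i<k ai≡α
    ... | inj₁ (s , S₀≡) = trans (cong (λ w → length w + p) S₀≡) (cong suc p≡) ,
                           subst (λ w → ¬ FactorOf w (pal k)) (sym S₀≡α) (fresh-not-factor k α fresh)
      where
      s≡α : s ≡ α
      s≡α = ∷ʳ-injectiveʳ (proj₁ suffix-S₀) (pal k) (trans (cong (proj₁ suffix-S₀ ++_) (sym S₀≡)) (proj₂ suffix-S₀))
      S₀≡α : S₀ ≡ α ∷ []
      S₀≡α = trans S₀≡ (cong (_∷ []) s≡α)

    module OldCase (i : ℕ) (last : LastDirected k α i) (p+pal-i≡n : p + length (pal i) ≡ n) where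
      i<k : i < k
      i<k = proj₁ last
      ai≡α : a (suc i) ≡ α
      ai≡α = proj₁ (proj₂ last)
      after : ∀ l → i < l → l < k → a (suc l) ≢ α
      after = proj₂ (proj₂ last)

      SS : List A
      SS = α ∷ (pal i ∷ʳ α)

      length-SS : length SS ≡ suc (suc (length (pal i)))
      length-SS = cong suc (length-∷ʳ (pal i) α)

      suffix-SS : Suffix SS (pal k ∷ʳ α)
      suffix-SS = Q , trans (sym (++-assoc Q (α ∷ pal i) (α ∷ []))) (cong (_∷ʳ α) (trans (cong (λ e → Q ++ e ∷ pal i) (sym ai≡α)) Q≡))
        where
        Q : List A
        Q = proj₁ (letter-pal-suffix i k i<k)
        Q≡ : Q ++ a (suc i) ∷ pal i ≡ pal k
        Q≡ = proj₂ (letter-pal-suffix i k i<k)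

      palindrome-SS : Palindrome SS
      palindrome-SS = trans (unfold-reverse α (pal i ∷ʳ α)) (cong (_∷ʳ α) (trans (reverse-∷ʳ (pal i) α) (cong (α ∷_) (pal-palindrome i))))

      SS≤S₀ : length SS ≤ length S₀
      SS≤S₀ = maximal SS palindrome-SS suffix-SS

      -- ... and S₀, having length at least two, is  α · pal i' · α  for a step i' directed by α;
      -- the maximality of S₀ and of i force i' = i.
      S₀-shape : ∃ λ i' → i' < k × a (suc i') ≡ α × S₀ ≡ α ∷ (pal i' ∷ʳ α)
      S₀-shape = palindromic-suffix-shape k α S₀ pal-S₀ suffix-S₀ (≤-trans (s≤s (s≤s z≤n)) (subst (_≤ length S₀) length-SS SS≤S₀))

      same-step : (∃ λ i' → i' < k × a (suc i') ≡ α × S₀ ≡ α ∷ (pal i' ∷ʳ α)) → S₀ ≡ SS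
      same-step (i' , i'<k , ai'≡α , S₀≡) with <-cmp i' i
      ... | tri≈ _ refl _ = S₀≡
      ... | tri> _ _ i<i' = ⊥-elim (after i' i<i' i'<k ai'≡α)
      ... | tri< i'<i _ _ = ⊥-elim (<⇒≱ shorter longer)
        where
        shorter : length (pal i') < length (pal i)
        shorter = subst₂ _<_ (cong length (proj₁ (invariant i'))) (cong length (proj₁ (invariant i))) (β-< i'<i)
        longer : length (pal i) ≤ length (pal i')
        longer = ≤-pred (≤-pred (subst₂ _≤_ length-SS (trans (cong length S₀≡) (cong suc (length-∷ʳ (pal i') α))) SS≤S₀))

      S₀≡SS : S₀ ≡ SS
      S₀≡SS = same-step S₀-shape

      length-S₀ : length S₀ + p ≡ suc (suc n)
      length-S₀ = trans (cong (λ w → length w + p) S₀≡SS) (trans (cong (_+ p) length-SS)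
                        (cong (λ m → suc (suc m)) (trans (+-comm (length (pal i)) p) p+pal-i≡n)))

      m : ℕ
      m = k ∸ suc i

      m+i≡k : suc m + i ≡ k
      m+i≡k = trans (cong suc (+-comm m i)) (m+[n∸m]≡n i<k)

      Ds : List A
      Ds = Shifted.pal i (suc m)

      pal-k≡ : pal k ≡ expand i Ds ++ pal i
      pal-k≡ = trans (cong pal (sym m+i≡k)) (pal-desubst i (suc m))

      avoids : Shifted.Avoids i α (suc m)
      avoids l 0<l l<1+m = after (l + i) (m<n+m i 0<l) (subst (l + i <_) m+i≡k (+-monoˡ-< i l<1+m))

      square-free : ¬ HasSquare α Ds
      square-free = proj₂ (Shifted.pal-shape i ai≡α m avoids)

      not-factor : ¬ FactorOf S₀ (pal k)
      not-factor (t , occ) = square-free (SquareOccurrence.square-occurrence i α Ds T (length Pre) occ-V fits occ-SS)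
        where
        occ-SS-pal : OccursAt SS (pal k) t
        occ-SS-pal = subst (λ w → OccursAt w (pal k) t) S₀≡SS occ
        split : ∃₂ λ Pre Suf → pal k ≡ Pre ++ SS ++ Suf × length Pre ≡ t
        split = occursAt⇒split SS (pal k) t occ-SS-pal
        Pre : List A
        Pre = proj₁ split
        Suf : List A
        Suf = proj₁ (proj₂ split)
        pal≡ : pal k ≡ Pre ++ SS ++ Suf
        pal≡ = proj₁ (proj₂ (proj₂ split))
        T : ℕ
        T = proj₁ (ls⇒factor (ls-pal k))
        occ-pal : Occ T (pal k)
        occ-pal = proj₂ (ls⇒factor (ls-pal k))
        occ-V : Occ T (expand i Ds ++ pal i)
        occ-V = subst (Occ T) pal-k≡ occ-pal
        occ-SS : Occ (T + length Pre) SS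
        occ-SS = occ-prefix _ SS Suf (occ-suffix T Pre (SS ++ Suf) (subst (Occ T) pal≡ occ-pal))
        fits : length Pre + length SS ≤ length (expand i Ds ++ pal i)
        fits = subst₂ _≤_ (cong (_+ length SS) (sym (proj₂ (proj₂ (proj₂ split))))) (cong length pal-k≡) (proj₁ occ-SS-pal)

    core : Core
    core with block-length k α
    ... | inj₁ (fresh , p≡) = fresh-case fresh p≡
    ... | inj₂ (i , last , p+pal-i≡n) = OldCase.length-S₀ i last p+pal-i≡n , OldCase.not-factor i last p+pal-i≡n

    not-factor : ¬ FactorOf S₀ (pal k)
    not-factor = proj₂ core

    W : List A
    W = pal (suc k)
    Xs : List A
    Xs = proj₁ suffix-S₀
    rest : List A
    rest = proj₁ (block-pal-starts-with k α)

    W≡ : W ≡ Xs ++ S₀ ++ rest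
    W≡ = begin
      W                      ≡⟨ proj₂ (block-pal-starts-with k α) ⟩
      pal k ++ α ∷ rest      ≡⟨ ++-assoc (pal k) (α ∷ []) rest ⟨
      (pal k ∷ʳ α) ++ rest   ≡⟨ cong (_++ rest) (proj₂ suffix-S₀) ⟨
      (Xs ++ S₀) ++ rest     ≡⟨ ++-assoc Xs S₀ rest ⟩
      Xs ++ S₀ ++ rest       ∎
      where open ≡-Reasoning

    length-Xs : length Xs + length S₀ ≡ suc n
    length-Xs = trans (sym (length-++ Xs)) (trans (cong length (proj₂ suffix-S₀)) (length-∷ʳ (pal k) α))

    1+Xs≡p : suc (length Xs) ≡ p
    1+Xs≡p = +-cancelˡ-≡ (length S₀) _ _ (trans (+-suc (length S₀) (length Xs))
               (trans (cong suc (trans (+-comm (length S₀) (length Xs)) length-Xs)) (sym (proj₁ core))))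

    length-W : length W ≡ p + n
    length-W = length-++ (block k α)

    early-impossible : ∀ Pre Suf → W ≡ Pre ++ S₀ ++ Suf → length Pre + length S₀ ≤ n → ⊥
    early-impossible Pre Suf W≡' fits
      with ++-overlap Pre (S₀ ++ Suf) (pal k) (α ∷ rest) (trans (sym W≡') (proj₂ (block-pal-starts-with k α)))
                      (≤-trans (m≤m+n (length Pre) (length S₀)) fits)
    ... | M , pal≡ , S₀Suf≡
      with ++-overlap S₀ Suf M (α ∷ rest) S₀Suf≡
                      (+-cancelˡ-≤ (length Pre) _ _ (subst (length Pre + length S₀ ≤_) (trans (cong length pal≡) (length-++ Pre)) fits))
    ... | M' , M≡ , _ = not-factor (length Pre , split⇒occursAt Pre S₀ M' (trans pal≡ (cong (Pre ++_) M≡)))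

    -- Any other occurrence ends inside pal k, or (mirrored in the palindromes W and S₀) starts after it.
    unique : ∀ j → OccursAt S₀ W j → j ≡ length Xs
    unique j occ with occursAt⇒split S₀ W j occ
    ... | Pre , Suf , W≡' , Pre≡j with <-cmp j (length Xs)
    ...   | tri≈ _ j≡Xs _ = j≡Xs
    ...   | tri< j<Xs _ _ = ⊥-elim (early-impossible Pre Suf W≡'
              (≤-pred (subst (length Pre + length S₀ <_) length-Xs (+-monoˡ-< (length S₀) (subst (_< length Xs) (sym Pre≡j) j<Xs)))))
    ...   | tri> _ _ Xs<j = ⊥-elim (early-impossible (reverse Suf) (reverse Pre) mirrored fits)
      where
      open ≡-Reasoning
      mirrored : W ≡ reverse Suf ++ S₀ ++ reverse Pre
      mirrored = begin
        W                                             ≡⟨ block-pal-palindrome k α (pal-palindrome k) ⟨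
        reverse W                                     ≡⟨ cong reverse W≡' ⟩
        reverse (Pre ++ S₀ ++ Suf)                    ≡⟨ reverse-++ Pre (S₀ ++ Suf) ⟩
        reverse (S₀ ++ Suf) ++ reverse Pre            ≡⟨ cong (_++ reverse Pre) (reverse-++ S₀ Suf) ⟩
        (reverse Suf ++ reverse S₀) ++ reverse Pre    ≡⟨ cong (λ w → (reverse Suf ++ w) ++ reverse Pre) pal-S₀ ⟩
        (reverse Suf ++ S₀) ++ reverse Pre            ≡⟨ ++-assoc (reverse Suf) S₀ (reverse Pre) ⟩
        reverse Suf ++ S₀ ++ reverse Pre              ∎
      total : length Pre + (length S₀ + length Suf) ≡ p + n
      total = trans (sym (trans (length-++ Pre) (cong (length Pre +_) (length-++ S₀)))) (trans (cong length (sym W≡')) length-W)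
      p≤Pre : p ≤ length Pre
      p≤Pre = subst₂ _≤_ 1+Xs≡p (sym Pre≡j) Xs<j
      fits : length (reverse Suf) + length S₀ ≤ n
      fits = subst (_≤ n) (trans (+-comm (length S₀) (length Suf)) (cong (_+ length S₀) (sym (length-reverse Suf))))
               (+-cancelˡ-≤ p _ _ (subst (p + (length S₀ + length Suf) ≤_) total (+-monoˡ-≤ _ p≤Pre)))

    occurs-once : OccursExactlyOnce S₀ W
    occurs-once = length Xs , split⇒occursAt Xs S₀ rest W≡ , unique

two-letters : ∀ {d} → 2 ≤ d → Σ (Fin d) λ c → Σ (Fin d) λ c' → c ≢ c'
two-letters (s≤s (s≤s _)) = fzero , fsuc fzero , λ ()

lemma2 : (d : ℕ) → 2 ≤ d → (x : ℕ → Fin d) → ArnouxRauzy x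
    → (B : ℕ → List (Fin d))
    → (∀ k → Bispecial x (B k))
    → (∀ k → length (B k) < length (B (suc k)))
    → (∀ w → Bispecial x w → ∃ λ k → w ≡ B k)
    → (a : ℕ → Fin d)
    → (∀ k → LeftSpecial x (B k ∷ʳ a (suc k)))
    → (S : ℕ → List (Fin d))
    → (∀ k → IsLongestPalSuffix (S (suc k)) (B k ∷ʳ a (suc k)))
    → ∀ k → OccursExactlyOnce (S (suc k)) (B (suc k))
            × ¬ FactorOf (S (suc k)) (B k)
-- Since B k = pal k for every k, the statement is the one proved for the model words.
lemma2 d 2≤d x AR B bis increasing all a ls-Ba S longest k =
  subst (OccursExactlyOnce (S (suc k))) (sym (proj₁ (invariant (suc k)))) occurs-once ,
  subst (λ w → ¬ FactorOf (S (suc k)) w) (sym (proj₁ (invariant k))) not-factor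
  where
  letters : Σ (Fin d) λ c → Σ (Fin d) λ c' → c ≢ c'
  letters = two-letters 2≤d
  open Enumeration _≟F_ (proj₁ letters) (proj₁ (proj₂ letters)) (proj₂ (proj₂ letters)) x AR B bis increasing all a ls-Ba
  open LongestPalindromicSuffix k (S (suc k))
         (subst (λ w → IsLongestPalSuffix (S (suc k)) (w ∷ʳ a (suc k))) (proj₁ (invariant k)) (longest k))
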